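{- Let $Q$ be a quiver on $n$ vertices and suppose $i$ is an exit in $Q$. Let $Q'=\mu[i](Q)$. Consider the induced subgraph of the mutation graph whose vertices are all quivers of the form $\mu[i_\ell\cdots i_1 i](Q)$ for sequences $i\ne i_1\ne i_2\ne\cdots\ne i_\ell$, $\ell\ge 0$ (including $Q'$). This subgraph is a complete rooted $(n-1)$-ary tree with root $Q'$.
   Context: Quivers are finite directed multigraphs without loops or oriented 2-cycles, labeled, encoded by skew-symmetric $B(Q)=(b_{ij})$; mutation at $k$: $b'_{ij}=-b_{ij}$ if $k\in\{i,j\}$, else $b'_{ij}=b_{ij}+\tfrac12(|b_{ik}|b_{kj}+b_{ik}|b_{kj}|)$. $\mu[i_\ell\cdots i_1 i]$ means mutate at $i$ first, then $i_1$, ..., then $i_\ell$. The mutation graph has as vertices the quivers in the mutation class of $Q$ and an edge labeled $j$ joining $P$ and $\mu[j](P)$. A vertex $i$ of $Q$ is an exit if for every sequence $i\ne i_1\ne\cdots\ne i_\ell$ ($\ell\ge 0$) we have $Q\ne\mu[i_\ell\cdots i_1 i](Q)$. -}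

module Defs where

open import Data.Nat using (ℕ)
open import Data.Integer using (ℤ; +_; -_; _+_; _*_; ∣_∣)
open import Data.Integer.DivMod using (_/_)
open import Data.Fin using (Fin; _≟_)
open import Data.List using (List; []; _∷_; _∷ʳ_)
open import Data.Product using (_×_; Σ; _,_)
open import Data.Sum using (_⊎_)
open import Data.Unit using (⊤)
open import Relation.Nullary using (¬_; yes; no)
open import Relation.Binary.PropositionalEquality using (_≡_; _≢_)
open import Function.Bundles using (_⇔_)

-- A (labeled) quiver on n vertices is encoded by its exchange matrix B(Q).
Matrix : ℕ → Set
Matrix n = Fin n → Fin n → ℤ

SkewSymmetric : {n : ℕ} → Matrix n → Set
SkewSymmetric B = ∀ i j → B j i ≡ - B i j

-- Equality of (labeled) quivers = equality of their matrices (entrywise).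
_≈Q_ : {n : ℕ} → Matrix n → Matrix n → Set
B ≈Q C = ∀ i j → B i j ≡ C i j

infix 4 _≈Q_

μ : {n : ℕ} → Fin n → Matrix n → Matrix n
μ k B i j with i ≟ k | j ≟ k
... | yes _ | _     = - B i j
... | no _  | yes _ = - B i j
... | no _  | no _  =
  B i j + ((+ ∣ B i k ∣) * B k j + B i k * (+ ∣ B k j ∣)) / (+ 2)

-- Apply a sequence of mutations, first element first:
-- mutSeq B (i₁ ∷ i₂ ∷ … ∷ iℓ ∷ []) = μ[iℓ ⋯ i₂ i₁](B).
mutSeq : {n : ℕ} → Matrix n → List (Fin n) → Matrix n
mutSeq B []      = B
mutSeq B (j ∷ w) = mutSeq (μ j B) w

Chain : {n : ℕ} → Fin n → List (Fin n) → Set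
Chain a []      = ⊤
Chain a (b ∷ w) = (a ≢ b) × Chain b w

IsExit : {n : ℕ} → Matrix n → Fin n → Set
IsExit Q i = ∀ w → Chain i w → ¬ (Q ≈Q mutSeq Q (i ∷ w))

-- The vertex of the mutation graph reached from Q by the word i ∷ w,
-- i.e. μ[iℓ ⋯ i₁ i](Q) for w = i₁ ∷ ⋯ ∷ iℓ ∷ [].  The empty word gives
-- the root Q' = μ[i](Q).
--
-- The complete rooted (n-1)-ary tree with root Q' is realised on the set of
-- words w with Chain i w (the children of w are w ∷ʳ j with j different from
-- the last letter of i ∷ w, so every node has exactly n-1 children), with an
-- edge labeled j between w and w ∷ʳ j.
--
-- "The induced subgraph of the mutation graph on the vertices
--  { μ[iℓ ⋯ i₁ i](Q) } is this tree with root Q'" means: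
--   * the map w ↦ μ[iℓ ⋯ i₁ i](Q) is injective on such words (so the
--     vertices are in bijection with the tree nodes, [] ↦ Q'), and
--   * two such vertices P = μ[u](..) and R = μ[v](..) are joined by an edge
--     labeled j of the mutation graph (R = μ[j](P)) iff u and v are joined
--     by the tree edge labeled j (no further edges, loops or multi-edges).
InducedSubgraphIsCompleteTree : {n : ℕ} → Matrix n → Fin n → Set
InducedSubgraphIsCompleteTree Q i =
  ( ∀ u v → Chain i u → Chain i v →
      mutSeq Q (i ∷ u) ≈Q mutSeq Q (i ∷ v) → u ≡ v )
  ×
  ( ∀ u v j → Chain i u → Chain i v →
      ( μ j (mutSeq Q (i ∷ u)) ≈Q mutSeq Q (i ∷ v)
        ⇔ ((v ≡ u ∷ʳ j) ⊎ (u ≡ v ∷ʳ j)) ) )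

-- Each mutation μₖ is an involution, so quivers reached by words in the mutations behave
-- like elements of a free product of copies of ℤ/2 acting on Q.  If two different reduced
-- words starting at i gave the same quiver, cancelling their common outermost letters
-- would leave a nontrivial reduced word starting at i that returns Q to itself, which the
-- exit hypothesis forbids.  Hence distinct reduced words give distinct quivers, and μⱼ of
-- the quiver of a word w is the quiver of w extended by j, or of w with its last letter j
-- removed; this is exactly the complete (n-1)-ary tree.
module Submission where

open import Defs
open import Data.Nat using (ℕ; zero; suc)
import Data.Nat as ℕ
import Data.Nat.DivMod as ℕ
open import Data.Fin using (Fin; _≟_)
open import Data.Integer using (ℤ; +_; -[1+_]; 0ℤ; -_; _+_; _*_; ∣_∣; _/_)
open import Data.Integer.Properties
  using (+∣i∣≡i⊎+∣i∣≡-i; ∣-i∣≡∣i∣; neg-involutive; neg-distrib-+; neg-distribˡ-*;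
         neg-distribʳ-*; pos-*; *-identityˡ; *-identityʳ; *-distribˡ-+;
         +-assoc; +-inverseˡ; +-inverseʳ; +-identityʳ)
open import Data.List using (List; []; _∷_; _∷ʳ_; _ʳ++_; reverse)
open import Data.List.Properties using (∷-injectiveʳ; reverse-injective; reverse-++; unfold-reverse; ++-conicalʳ)
open import Data.Product using (∃; _×_; _,_)
open import Data.Sum using (_⊎_; inj₁; inj₂)
open import Data.Sum.Function.Propositional using (_⊎-⇔_)
open import Data.Unit using (⊤; tt)
open import Data.Empty using (⊥-elim)
open import Relation.Nullary using (¬_; Dec; yes; no)
open import Relation.Binary.PropositionalEquality
open import Function.Bundles using (_⇔_; mk⇔)
import Function.Properties.Equivalence as ⇔

-- Off the cross of row and column k, μ k sets b'ᵢⱼ = bᵢⱼ + exchangeTerm bᵢₖ bₖⱼ / 2.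
exchangeTerm : ℤ → ℤ → ℤ
exchangeTerm a b = + ∣ a ∣ * b + a * + ∣ b ∣

exchangeTerm-neg : ∀ a b → exchangeTerm (- a) (- b) ≡ - exchangeTerm a b
exchangeTerm-neg a b = begin
  + ∣ - a ∣ * - b + - a * + ∣ - b ∣   ≡⟨ cong₂ (λ s t → + s * - b + - a * + t) (∣-i∣≡∣i∣ a) (∣-i∣≡∣i∣ b) ⟩
  + ∣ a ∣ * - b + - a * + ∣ b ∣       ≡⟨ cong₂ _+_ (neg-distribʳ-* (+ ∣ a ∣) b) (neg-distribˡ-* a (+ ∣ b ∣)) ⟨
  - (+ ∣ a ∣ * b) + - (a * + ∣ b ∣)   ≡⟨ neg-distrib-+ (+ ∣ a ∣ * b) (a * + ∣ b ∣) ⟨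
  - exchangeTerm a b                  ∎
  where open ≡-Reasoning

i+i≡i*2 : ∀ i → i + i ≡ i * + 2
i+i≡i*2 i = sym (trans (*-distribˡ-+ i (+ 1) (+ 1)) (cong₂ _+_ (*-identityʳ i) (*-identityʳ i)))

exchangeTerm-even : ∀ a b → ∃ λ y → exchangeTerm a b ≡ y * + 2
exchangeTerm-even a b with +∣i∣≡i⊎+∣i∣≡-i a | +∣i∣≡i⊎+∣i∣≡-i b
... | inj₁ ∣a∣ | inj₁ ∣b∣ = a * b , (begin
  exchangeTerm a b  ≡⟨ cong₂ (λ s t → s * b + a * t) ∣a∣ ∣b∣ ⟩
  a * b + a * b     ≡⟨ i+i≡i*2 (a * b) ⟩
  a * b * + 2       ∎)
  where open ≡-Reasoning
... | inj₁ ∣a∣ | inj₂ ∣b∣ = 0ℤ , (begin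
  exchangeTerm a b   ≡⟨ cong₂ (λ s t → s * b + a * t) ∣a∣ ∣b∣ ⟩
  a * b + a * - b    ≡⟨ cong (_+_ (a * b)) (neg-distribʳ-* a b) ⟨
  a * b + - (a * b)  ≡⟨ +-inverseʳ (a * b) ⟩
  0ℤ                 ∎)
  where open ≡-Reasoning
... | inj₂ ∣a∣ | inj₁ ∣b∣ = 0ℤ , (begin
  exchangeTerm a b   ≡⟨ cong₂ (λ s t → s * b + a * t) ∣a∣ ∣b∣ ⟩
  - a * b + a * b    ≡⟨ cong (_+ (a * b)) (neg-distribˡ-* a b) ⟨
  - (a * b) + a * b  ≡⟨ +-inverseˡ (a * b) ⟩
  0ℤ                 ∎)
  where open ≡-Reasoning
... | inj₂ ∣a∣ | inj₂ ∣b∣ = - (a * b) , (begin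
  exchangeTerm a b         ≡⟨ cong₂ (λ s t → s * b + a * t) ∣a∣ ∣b∣ ⟩
  - a * b + a * - b        ≡⟨ cong₂ _+_ (neg-distribˡ-* a b) (neg-distribʳ-* a b) ⟨
  - (a * b) + - (a * b)    ≡⟨ i+i≡i*2 (- (a * b)) ⟩
  - (a * b) * + 2          ∎)
  where open ≡-Reasoning

i*2/2≡i : ∀ i → i * + 2 / + 2 ≡ i
i*2/2≡i (+ k) = begin
  + k * + 2 / + 2     ≡⟨ cong (_/ + 2) (pos-* k 2) ⟨
  + (k ℕ.* 2) / + 2   ≡⟨ *-identityˡ _ ⟩
  + (k ℕ.* 2 ℕ./ 2)   ≡⟨ cong +_ (ℕ.m*n/n≡m k 2) ⟩
  + k                 ∎
  where open ≡-Reasoning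
i*2/2≡i -[1+ k ] with suc (suc (k ℕ.* 2)) ℕ.% 2 in rem
... | zero = begin
  _                                 ≡⟨ *-identityˡ _ ⟩
  - (+ (suc (suc (k ℕ.* 2)) ℕ./ 2)) ≡⟨ cong (λ t → - (+ t)) (ℕ.m*n/n≡m (suc k) 2) ⟩
  -[1+ k ]                          ∎
  where open ≡-Reasoning
... | suc _ with () ← trans (sym rem) (ℕ.m*n%n≡0 (suc k) 2)

half-exchangeTerm-neg : ∀ a b → exchangeTerm (- a) (- b) / + 2 ≡ - (exchangeTerm a b / + 2)
half-exchangeTerm-neg a b with exchangeTerm-even a b
... | y , even = begin
  exchangeTerm (- a) (- b) / + 2  ≡⟨ cong (_/ + 2) (exchangeTerm-neg a b) ⟩
  - exchangeTerm a b / + 2        ≡⟨ cong (λ t → - t / + 2) even ⟩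
  - (y * + 2) / + 2               ≡⟨ cong (_/ + 2) (neg-distribˡ-* y (+ 2)) ⟩
  - y * + 2 / + 2                 ≡⟨ i*2/2≡i (- y) ⟩
  - y                             ≡⟨ cong -_ (i*2/2≡i y) ⟨
  - (y * + 2 / + 2)               ≡⟨ cong (λ t → - (t / + 2)) even ⟨
  - (exchangeTerm a b / + 2)      ∎
  where open ≡-Reasoning

module _ {n : ℕ} where

  ≈Q-refl : {B : Matrix n} → B ≈Q B
  ≈Q-refl _ _ = refl

  ≈Q-sym : {B C : Matrix n} → B ≈Q C → C ≈Q B
  ≈Q-sym e i j = sym (e i j)

  ≈Q-trans : {B C D : Matrix n} → B ≈Q C → C ≈Q D → B ≈Q D
  ≈Q-trans e f i j = trans (e i j) (f i j)

  μ-cong : (k : Fin n) {B C : Matrix n} → B ≈Q C → μ k B ≈Q μ k C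
  μ-cong k e i j with i ≟ k | j ≟ k
  ... | yes _ | _     = cong -_ (e i j)
  ... | no _  | yes _ = cong -_ (e i j)
  ... | no _  | no _  rewrite e i j | e i k | e k j = refl

  μ-negatesColumn : (k : Fin n) (B : Matrix n) (i : Fin n) → μ k B i k ≡ - B i k
  μ-negatesColumn k B i with i ≟ k | k ≟ k
  ... | yes _ | _      = refl
  ... | no _  | yes _  = refl
  ... | no _  | no k≢k = ⊥-elim (k≢k refl)

  μ-negatesRow : (k : Fin n) (B : Matrix n) (j : Fin n) → μ k B k j ≡ - B k j
  μ-negatesRow k B j with k ≟ k
  ... | yes _  = refl
  ... | no k≢k = ⊥-elim (k≢k refl)

  μ-offCross : (k : Fin n) (B : Matrix n) {i j : Fin n} → i ≢ k → j ≢ k →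
               μ k B i j ≡ B i j + exchangeTerm (B i k) (B k j) / + 2
  μ-offCross k B {i} {j} i≢k j≢k with i ≟ k | j ≟ k
  ... | yes i≡k | _       = ⊥-elim (i≢k i≡k)
  ... | no _    | yes j≡k = ⊥-elim (j≢k j≡k)
  ... | no _    | no _    = refl

  μ-involutive : (k : Fin n) (B : Matrix n) → μ k (μ k B) ≈Q B
  μ-involutive k B i j = entry (i ≟ k) (j ≟ k)
    where
    open ≡-Reasoning
    entry : Dec (i ≡ k) → Dec (j ≡ k) → μ k (μ k B) i j ≡ B i j
    entry (yes refl) _ = begin
      μ k (μ k B) k j  ≡⟨ μ-negatesRow k (μ k B) j ⟩
      - μ k B k j      ≡⟨ cong -_ (μ-negatesRow k B j) ⟩
      - - B k j        ≡⟨ neg-involutive (B k j) ⟩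
      B k j            ∎
    entry (no _) (yes refl) = begin
      μ k (μ k B) i k  ≡⟨ μ-negatesColumn k (μ k B) i ⟩
      - μ k B i k      ≡⟨ cong -_ (μ-negatesColumn k B i) ⟩
      - - B i k        ≡⟨ neg-involutive (B i k) ⟩
      B i k            ∎
    entry (no i≢k) (no j≢k) = begin
      μ k (μ k B) i j
        ≡⟨ μ-offCross k (μ k B) i≢k j≢k ⟩
      μ k B i j + exchangeTerm (μ k B i k) (μ k B k j) / + 2
        ≡⟨ cong₂ (λ a b → μ k B i j + exchangeTerm a b / + 2) (μ-negatesColumn k B i) (μ-negatesRow k B j) ⟩
      μ k B i j + exchangeTerm (- B i k) (- B k j) / + 2
        ≡⟨ cong₂ _+_ (μ-offCross k B i≢k j≢k) (half-exchangeTerm-neg (B i k) (B k j)) ⟩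
      (B i j + t) + - t   ≡⟨ +-assoc (B i j) t (- t) ⟩
      B i j + (t + - t)   ≡⟨ cong (_+_ (B i j)) (+-inverseʳ t) ⟩
      B i j + 0ℤ          ≡⟨ +-identityʳ (B i j) ⟩
      B i j               ∎
      where
      t : ℤ
      t = exchangeTerm (B i k) (B k j) / + 2

  μ-cancel : (k : Fin n) {B C : Matrix n} → μ k B ≈Q μ k C → B ≈Q C
  μ-cancel k {B} {C} e =
    ≈Q-trans (≈Q-sym (μ-involutive k B)) (≈Q-trans (μ-cong k e) (μ-involutive k C))

  mutSeq-cong : {B C : Matrix n} (w : List (Fin n)) → B ≈Q C → mutSeq B w ≈Q mutSeq C w
  mutSeq-cong []      e = e
  mutSeq-cong (k ∷ w) e = mutSeq-cong w (μ-cong k e)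

  -- The paper's μ[iℓ ⋯ i₁ i](B) is μ⟦ iℓ ∷ ⋯ ∷ i₁ ∷ i ∷ [] ⟧ B: the head is mutated last.
  μ⟦_⟧ : List (Fin n) → Matrix n → Matrix n
  μ⟦ []    ⟧ B = B
  μ⟦ k ∷ X ⟧ B = μ k (μ⟦ X ⟧ B)

  mutSeq-μ⟦⟧ : (B : Matrix n) (X w : List (Fin n)) → mutSeq (μ⟦ X ⟧ B) w ≡ μ⟦ w ʳ++ X ⟧ B
  mutSeq-μ⟦⟧ B X []      = refl
  mutSeq-μ⟦⟧ B X (k ∷ w) = mutSeq-μ⟦⟧ B (k ∷ X) w

  mutSeq≡μ⟦reverse⟧ : (B : Matrix n) (w : List (Fin n)) → mutSeq B w ≡ μ⟦ reverse w ⟧ B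
  mutSeq≡μ⟦reverse⟧ B = mutSeq-μ⟦⟧ B []

  mutSeq-μ⟦⟧-cancel : (B : Matrix n) (X : List (Fin n)) → mutSeq (μ⟦ X ⟧ B) X ≈Q B
  mutSeq-μ⟦⟧-cancel B []      = ≈Q-refl
  mutSeq-μ⟦⟧-cancel B (k ∷ X) =
    ≈Q-trans (mutSeq-cong X (μ-involutive k (μ⟦ X ⟧ B))) (mutSeq-μ⟦⟧-cancel B X)

  -- Paper-order counterpart of Chain: X = iℓ ∷ ⋯ ∷ i₁ ∷ i ∷ [] with i ≠ i₁ ≠ ⋯ ≠ iℓ;
  -- X = [] is allowed and stands for Q itself.
  ReducedEndingIn : Fin n → List (Fin n) → Set
  ReducedEndingIn i []          = ⊤
  ReducedEndingIn i (a ∷ [])    = a ≡ i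
  ReducedEndingIn i (a ∷ b ∷ X) = a ≢ b × ReducedEndingIn i (b ∷ X)

  reducedEndingIn-tail : ∀ {i a} X → ReducedEndingIn i (a ∷ X) → ReducedEndingIn i X
  reducedEndingIn-tail []      _       = tt
  reducedEndingIn-tail (_ ∷ _) (_ , r) = r

  reducedEndingIn⇒chain : ∀ {i a} X → ReducedEndingIn i (a ∷ X) → Chain a X
  reducedEndingIn⇒chain []      _         = tt
  reducedEndingIn⇒chain (b ∷ X) (a≢b , r) = a≢b , reducedEndingIn⇒chain X r

  chain-ʳ++-reducedEndingIn : ∀ {i a} u X → Chain a u → ReducedEndingIn i (a ∷ X) →
                              ReducedEndingIn i (u ʳ++ (a ∷ X))
  chain-ʳ++-reducedEndingIn []      X _           r = r
  chain-ʳ++-reducedEndingIn (b ∷ u) X (a≢b , ch) r =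
    chain-ʳ++-reducedEndingIn u (_ ∷ X) ch (≢-sym a≢b , r)

  module _ {Q : Matrix n} {i : Fin n} (exit : IsExit Q i) where

    -- The mutations applied to Q form the word X ʳ++ a ∷ Z, which is reduced and starts at i.
    exit-noReturn : ∀ a X Z → ReducedEndingIn i (a ∷ X) → Chain a Z →
                    ¬ Q ≈Q mutSeq (μ⟦ a ∷ X ⟧ Q) Z
    exit-noReturn a []      Z refl        ch = exit Z ch
    exit-noReturn a (b ∷ X) Z (a≢b , r) ch =
      exit-noReturn b X (a ∷ Z) r (≢-sym a≢b , ch)

    μ⟦⟧-injective : ∀ X Y → ReducedEndingIn i X → ReducedEndingIn i Y →
                    μ⟦ X ⟧ Q ≈Q μ⟦ Y ⟧ Q → X ≡ Y
    μ⟦⟧-injective []      []      _  _  _ = refl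
    μ⟦⟧-injective []      (b ∷ Y) _  rY e = ⊥-elim (exit-noReturn b Y [] rY tt e)
    μ⟦⟧-injective (a ∷ X) []      rX _  e = ⊥-elim (exit-noReturn a X [] rX tt (≈Q-sym e))
    μ⟦⟧-injective (a ∷ X) (b ∷ Y) rX rY e with a ≟ b
    ... | yes refl = cong (a ∷_)
      (μ⟦⟧-injective X Y (reducedEndingIn-tail X rX) (reducedEndingIn-tail Y rY) (μ-cancel a e))
    ... | no a≢b = ⊥-elim (exit-noReturn a X (b ∷ Y) rX (a≢b , reducedEndingIn⇒chain Y rY)
      (≈Q-sym (≈Q-trans (mutSeq-cong (b ∷ Y) e) (mutSeq-μ⟦⟧-cancel Q (b ∷ Y)))))

    μ⟦⟧-adjacent : ∀ j X Y → X ≢ [] → ReducedEndingIn i X → ReducedEndingIn i Y →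
                   μ j (μ⟦ X ⟧ Q) ≈Q μ⟦ Y ⟧ Q ⇔ (Y ≡ j ∷ X ⊎ X ≡ j ∷ Y)
    μ⟦⟧-adjacent j []      Y X≢[] _  _  = ⊥-elim (X≢[] refl)
    μ⟦⟧-adjacent j (c ∷ X) Y _    rX rY = mk⇔ to from
      where
      to : μ j (μ⟦ c ∷ X ⟧ Q) ≈Q μ⟦ Y ⟧ Q → Y ≡ j ∷ c ∷ X ⊎ c ∷ X ≡ j ∷ Y
      to e with j ≟ c
      ... | yes refl = inj₂ (cong (j ∷_)
        (μ⟦⟧-injective X Y (reducedEndingIn-tail X rX) rY (≈Q-trans (≈Q-sym (μ-involutive j _)) e)))
      ... | no j≢c = inj₁ (sym (μ⟦⟧-injective (j ∷ c ∷ X) Y (j≢c , rX) rY e))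
      from : Y ≡ j ∷ c ∷ X ⊎ c ∷ X ≡ j ∷ Y → μ j (μ⟦ c ∷ X ⟧ Q) ≈Q μ⟦ Y ⟧ Q
      from (inj₁ refl) = ≈Q-refl
      from (inj₂ refl) = μ-involutive j (μ⟦ Y ⟧ Q)

reverse≡∷reverse⇔≡∷ʳ : {A : Set} (xs ys : List A) (x : A) →
                       reverse ys ≡ x ∷ reverse xs ⇔ ys ≡ xs ∷ʳ x
reverse≡∷reverse⇔≡∷ʳ xs ys x = mk⇔
  (λ e → reverse-injective (trans e (sym (reverse-++ xs (x ∷ [])))))
  (λ { refl → reverse-++ xs (x ∷ []) })

lemma6p11 : (n : ℕ) (Q : Matrix n) → SkewSymmetric Q →
    (i : Fin n) → IsExit Q i → InducedSubgraphIsCompleteTree Q i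
lemma6p11 n Q _ i exit = injective , adjacent
  where
  node : List (Fin n) → List (Fin n)
  node u = reverse (i ∷ u)

  node-reduced : ∀ {u} → Chain i u → ReducedEndingIn i (node u)
  node-reduced {u} ch = chain-ʳ++-reducedEndingIn u [] ch refl

  node-nonempty : ∀ u → node u ≢ []
  node-nonempty u e with () ← ++-conicalʳ (reverse u) (i ∷ []) (trans (sym (unfold-reverse i u)) e)

  node-∷ : ∀ u v j → node v ≡ j ∷ node u ⇔ v ≡ u ∷ʳ j
  node-∷ u v j = ⇔.trans (reverse≡∷reverse⇔≡∷ʳ (i ∷ u) (i ∷ v) j) (mk⇔ ∷-injectiveʳ (cong (i ∷_)))

  injective : ∀ u v → Chain i u → Chain i v → mutSeq Q (i ∷ u) ≈Q mutSeq Q (i ∷ v) → u ≡ v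
  injective u v cu cv e = ∷-injectiveʳ (reverse-injective
    (μ⟦⟧-injective exit (node u) (node v) (node-reduced cu) (node-reduced cv)
      (subst₂ _≈Q_ (mutSeq≡μ⟦reverse⟧ Q (i ∷ u)) (mutSeq≡μ⟦reverse⟧ Q (i ∷ v)) e)))

  adjacent : ∀ u v j → Chain i u → Chain i v →
             μ j (mutSeq Q (i ∷ u)) ≈Q mutSeq Q (i ∷ v) ⇔ (v ≡ u ∷ʳ j ⊎ u ≡ v ∷ʳ j)
  adjacent u v j cu cv
    rewrite mutSeq≡μ⟦reverse⟧ Q (i ∷ u) | mutSeq≡μ⟦reverse⟧ Q (i ∷ v) =
    ⇔.trans (μ⟦⟧-adjacent exit j (node u) (node v) (node-nonempty u) (node-reduced cu) (node-reduced cv))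
            (node-∷ u v j ⊎-⇔ node-∷ v u j)
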